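{- Let $G_1$ be a reduced graph (as defined in the context) and let $H$ be any maximum path-cycle cover of $G_1$. If $p$ is a path component of $H$ of length three neither of whose endpoints is a leaf of $G_1$, then some endpoint of $p$ is adjacent, via an edge of $G_1$, to a vertex not in $p$.
   Context: Throughout, $G_1$ is a connected undirected simple graph which is not a tree and which is reduced, meaning: (R1) every edge of $G_1$ whose two ends are each adjacent to a leaf (degree-$1$ vertex) of $G_1$ is a cut edge of $G_1$; (R2) no cut vertex of $G_1$ adjacent to a leaf of $G_1$ is super (a cut vertex is super if deleting it increases the number of connected components by at least $2$). Moreover it is assumed that no maximum path-cycle cover of $G_1$ consists of a single connected component. A path-cycle cover of $G_1$ is a spanning subgraph in which every vertex has degree at most $2$; it is maximum if it has the maximum number of edges among all path-cycle covers. Its connected components are path components and cycle components; the length of a path is its number of edges. A vertex of a path component is inner if its degree in the path is $2$ and an endpoint otherwise. -}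

module Defs where

open import Data.Nat using (ℕ; _≤_; _<_; _≥_)
open import Data.Fin using (Fin; toℕ)
open import Data.Bool using (Bool; true; false; _∧_)
open import Data.List using (List; []; _∷_; length; filterᵇ; allFin; concatMap; map)
open import Data.Product using (Σ; ∃; _×_; _,_)
open import Data.Sum using (_⊎_)
open import Data.Unit using (⊤)
open import Relation.Nullary using (¬_)
open import Relation.Binary.PropositionalEquality using (_≡_; _≢_)
open import Data.Nat using (_<ᵇ_)

Graph : ℕ → Set
Graph n = Fin n → Fin n → Bool

Adj : ∀ {n} → Graph n → Fin n → Fin n → Set
Adj G u v = G u v ≡ true

IsSimple : ∀ {n} → Graph n → Set
IsSimple {n} G = (∀ u v → G u v ≡ G v u) × (∀ v → G v v ≡ false)

data Walk {n} (G : Graph n) (ok : Fin n → Set) : Fin n → Fin n → Set where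
  here : ∀ {u} → ok u → Walk G ok u u
  step : ∀ {u w v} → ok u → Adj G u w → Walk G ok w v → Walk G ok u v


Connected : ∀ {n} → Graph n → Set
Connected {n} G = ∀ (u v : Fin n) → Walk G (λ _ → ⊤) u v

record Cycle {n} (G : Graph n) : Set where
  field
    len      : ℕ
    len≥3    : len ≥ 3
    vert     : Fin len → Fin n
    distinct : ∀ i j → vert i ≡ vert j → i ≡ j
    edges    : ∀ (i : Fin len) (j : Fin len) →
               toℕ j ≡ Data.Nat.suc (toℕ i) ⊎ (Data.Nat.suc (toℕ i) ≡ len × toℕ j ≡ 0) →
               Adj G (vert i) (vert j)

IsTree : ∀ {n} → Graph n → Set
IsTree G = Connected G × ¬ Cycle G

deg : ∀ {n} → Graph n → Fin n → ℕ
deg {n} G v = length (filterᵇ (G v) (allFin n))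

IsLeaf : ∀ {n} → Graph n → Fin n → Set
IsLeaf G v = deg G v ≡ 1

_─edge_,_ : ∀ {n} → Graph n → Fin n → Fin n → Graph n
(G ─edge u , v) x y with x Data.Fin.≟ u | y Data.Fin.≟ v | x Data.Fin.≟ v | y Data.Fin.≟ u
... | Relation.Nullary.yes _ | Relation.Nullary.yes _ | _ | _ = false
... | _ | _ | Relation.Nullary.yes _ | Relation.Nullary.yes _ = false
... | _ | _ | _ | _ = G x y

-- cut edge: removing it disconnects its two ends
-- (equivalently: increases the number of connected components)
IsCutEdge : ∀ {n} → Graph n → Fin n → Fin n → Set
IsCutEdge G u v = ¬ Walk (G ─edge u , v) (λ _ → ⊤) u v

ConnAvoid : ∀ {n} → Graph n → Fin n → Fin n → Fin n → Set
ConnAvoid G x a b = Walk G (λ w → w ≢ x) a b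

-- Super cut vertex of a CONNECTED graph G: G - x has at least 3 components
-- (the number of components increases by at least 2 from 1).
IsSuperCutVertex : ∀ {n} → Graph n → Fin n → Set
IsSuperCutVertex G x =
  Σ _ λ a → Σ _ λ b → Σ _ λ c →
    a ≢ x × b ≢ x × c ≢ x ×
    ¬ ConnAvoid G x a b × ¬ ConnAvoid G x a c × ¬ ConnAvoid G x b c

R1 : ∀ {n} → Graph n → Set
R1 G = ∀ u v → Adj G u v →
       (Σ _ λ l → IsLeaf G l × Adj G u l) →
       (Σ _ λ l → IsLeaf G l × Adj G v l) →
       IsCutEdge G u v

R2 : ∀ {n} → Graph n → Set
R2 G = ∀ x l → IsLeaf G l → Adj G x l → ¬ IsSuperCutVertex G x

Reduced : ∀ {n} → Graph n → Set
Reduced G = R1 G × R2 G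

numEdges : ∀ {n} → Graph n → ℕ
numEdges {n} G =
  length (filterᵇ (λ p → (toℕ (Data.Product.proj₁ p) <ᵇ toℕ (Data.Product.proj₂ p))
                          ∧ G (Data.Product.proj₁ p) (Data.Product.proj₂ p))
           (concatMap (λ i → map (λ j → (i , j)) (allFin n)) (allFin n)))

IsPCC : ∀ {n} → Graph n → Graph n → Set
IsPCC G H = IsSimple H × (∀ u v → Adj H u v → Adj G u v) × (∀ v → deg H v ≤ 2)

IsMaxPCC : ∀ {n} → Graph n → Graph n → Set
IsMaxPCC G H = IsPCC G H × (∀ H' → IsPCC G H' → numEdges H' ≤ numEdges H)

In4 : ∀ {n} → Fin n → Fin n → Fin n → Fin n → Fin n → Set
In4 a b c d x = x ≡ a ⊎ x ≡ b ⊎ x ≡ c ⊎ x ≡ d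

-- a – b – c – d is a path component of H of length three
-- (distinct vertices, exactly the edges ab, bc, cd among them, and closed
--  under H-adjacency, i.e. a whole connected component of H)
IsPathComp3 : ∀ {n} → Graph n → Fin n → Fin n → Fin n → Fin n → Set
IsPathComp3 H a b c d =
  (a ≢ b × a ≢ c × a ≢ d × b ≢ c × b ≢ d × c ≢ d) ×
  (Adj H a b × Adj H b c × Adj H c d) ×
  (¬ Adj H a c × ¬ Adj H b d × ¬ Adj H a d) ×
  (∀ x y → Adj H x y → In4 a b c d x → In4 a b c d y)

-- Suppose neither end of the path a–b–c–d has a neighbour in G₁ outside the path.
-- If ad is an edge of G₁, adding it to H closes the path into a cycle.  Otherwise,
-- since a and d are not leaves, their remaining neighbours force the edges ac and bd,
-- and trading bc for ac and bd turns the path into the 4-cycle a–b–d–c–a.  Either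
-- way H gains an edge while staying a path-cycle cover, contradicting maximality.
module Submission where

open import Defs
open import Data.Bool using (Bool; true; false; _∧_; _∨_; not; T)
open import Data.Bool.Properties using (T-≡; ⇔→≡; ¬-not; not-¬; ∧-distribˡ-∨) renaming (_≟_ to _≟ᵇ_)
open import Data.Fin using (Fin; toℕ; _≟_)
open import Data.Fin.Properties using (toℕ-injective; any?)
open import Data.List
  using (List; []; _∷_; _++_; length; filterᵇ; allFin; concatMap; map; cartesianProduct)
open import Data.List.Properties using (filter-none)
open import Data.List.Membership.Propositional using (_∈_)
open import Data.List.Membership.Propositional.Properties
  using (∈-filter⁺; ∈-allFin; ∈-cartesianProduct⁺)
open import Data.List.Relation.Unary.Any using (here; there)
open import Data.List.Relation.Unary.All as All using ()
open import Data.List.Relation.Unary.AllPairs using (_∷_)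
open import Data.List.Relation.Unary.Unique.Propositional using (Unique)
open import Data.List.Relation.Unary.Unique.Propositional.Properties
  using (allFin⁺; cartesianProduct⁺)
open import Data.Nat using (ℕ; suc; _+_; _≤_; _<_; z≤n; s≤s; s≤s⁻¹; _<ᵇ_)
open import Data.Nat.Properties
  using (≤-trans; ≤-reflexive; ≤-antisym; <-asym; <-cmp; m≤n⇒m≤1+n; n≤1+n; +-suc; +-comm;
         +-monoʳ-≤; +-monoˡ-≤; ≤⇒≯; <ᵇ⇒<; <⇒<ᵇ; module ≤-Reasoning)
open import Data.Product using (Σ; _×_; _,_; proj₁; proj₂)
open import Data.Sum using (_⊎_; inj₁; inj₂; swap)
open import Data.Empty using (⊥-elim)
open import Function using (_∘_; case_of_)
open import Function.Bundles using (Equivalence; mk⇔)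
open import Relation.Binary.Definitions using (tri<; tri≈; tri>)
open import Relation.Binary.PropositionalEquality
open import Relation.Nullary using (¬_; Dec; yes; no)
open import Relation.Nullary.Decidable using (T?; ¬?; _×-dec_; _⊎-dec_; decidable-stable)

module _ {A : Set} where

  length-filterᵇ-mono : ∀ {f g : A → Bool} xs → (∀ x → f x ≡ true → g x ≡ true) →
                        length (filterᵇ f xs) ≤ length (filterᵇ g xs)
  length-filterᵇ-mono [] _ = z≤n
  length-filterᵇ-mono {f} {g} (x ∷ xs) f⇒g with f x in fx | g x in gx
  ... | true  | true  = s≤s (length-filterᵇ-mono xs f⇒g)
  ... | true  | false = case trans (sym (f⇒g x fx)) gx of λ ()
  ... | false | true  = m≤n⇒m≤1+n (length-filterᵇ-mono xs f⇒g)
  ... | false | false = length-filterᵇ-mono xs f⇒g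

  length-filterᵇ-< : ∀ {f g : A → Bool} {p} xs → (∀ x → f x ≡ true → g x ≡ true) →
                     p ∈ xs → f p ≡ false → g p ≡ true →
                     length (filterᵇ f xs) < length (filterᵇ g xs)
  length-filterᵇ-< (x ∷ xs) f⇒g (here refl) fp gp rewrite fp | gp =
    s≤s (length-filterᵇ-mono xs f⇒g)
  length-filterᵇ-< {f} {g} (x ∷ xs) f⇒g (there p∈xs) fp gp with f x in fx | g x in gx
  ... | true  | true  = s≤s (length-filterᵇ-< xs f⇒g p∈xs fp gp)
  ... | true  | false = case trans (sym (f⇒g x fx)) gx of λ ()
  ... | false | true  = m≤n⇒m≤1+n (length-filterᵇ-< xs f⇒g p∈xs fp gp)
  ... | false | false = length-filterᵇ-< xs f⇒g p∈xs fp gp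

  length-filterᵇ-∨ : ∀ (f g : A → Bool) xs →
    length (filterᵇ (λ x → f x ∨ g x) xs) ≤ length (filterᵇ f xs) + length (filterᵇ g xs)
  length-filterᵇ-∨ f g [] = z≤n
  length-filterᵇ-∨ f g (x ∷ xs) with f x | g x
  ... | true  | true  = s≤s (≤-trans (length-filterᵇ-∨ f g xs) (+-monoʳ-≤ _ (n≤1+n _)))
  ... | true  | false = s≤s (length-filterᵇ-∨ f g xs)
  ... | false | true  rewrite +-suc (length (filterᵇ f xs)) (length (filterᵇ g xs)) =
    s≤s (length-filterᵇ-∨ f g xs)
  ... | false | false = length-filterᵇ-∨ f g xs

  length-filterᵇ-pos : ∀ {f : A → Bool} {p} xs → p ∈ xs → f p ≡ true → 1 ≤ length (filterᵇ f xs)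
  length-filterᵇ-pos {f} xs p∈xs fp
    with filterᵇ f xs | ∈-filter⁺ (T? ∘ f) p∈xs (Equivalence.from T-≡ fp)
  ... | _ ∷ _ | _ = s≤s z≤n

  length-filterᵇ-≤1 : ∀ {f : A → Bool} xs → Unique xs →
                      (∀ x y → f x ≡ true → f y ≡ true → x ≡ y) → length (filterᵇ f xs) ≤ 1
  length-filterᵇ-≤1 [] _ _ = z≤n
  length-filterᵇ-≤1 {f} (x ∷ xs) (x∉xs ∷ unique) f-unique with f x in fx
  ... | false = length-filterᵇ-≤1 xs unique f-unique
  ... | true = ≤-reflexive (cong (suc ∘ length) (filter-none (T? ∘ f) (All.map others-fail x∉xs)))
    where
    others-fail : ∀ {y} → x ≢ y → ¬ T (f y)
    others-fail x≢y = x≢y ∘ f-unique x _ fx ∘ Equivalence.to T-≡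

module _ {n : ℕ} where

  IsSymmetric : Graph n → Set
  IsSymmetric G = ∀ u v → G u v ≡ G v u

  _⊆_ : Graph n → Graph n → Set
  H ⊆ G = ∀ u v → Adj H u v → Adj G u v

  IsEdge : Fin n → Fin n → Fin n → Fin n → Set
  IsEdge u v x y = (x ≡ u × y ≡ v) ⊎ (x ≡ v × y ≡ u)

  isEdge? : ∀ u v x y → Dec (IsEdge u v x y)
  isEdge? u v x y = ((x ≟ u) ×-dec (y ≟ v)) ⊎-dec ((x ≟ v) ×-dec (y ≟ u))

  -- Defined by `with` rather than as `does (isEdge? u v x y)`, which would unfold
  -- into the component decisions and prevent matching on `isEdge?` in proofs.
  edge : Fin n → Fin n → Graph n
  edge u v x y with isEdge? u v x y
  ... | yes _ = true
  ... | no _  = false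

  _∪_ : Graph n → Graph n → Graph n
  (G ∪ K) x y = G x y ∨ K x y

  _∖_ : Graph n → Graph n → Graph n
  (G ∖ K) x y = G x y ∧ not (K x y)

  Adj? : ∀ (G : Graph n) x y → Dec (Adj G x y)
  Adj? G x y = G x y ≟ᵇ true

  ≡false⇒¬Adj : ∀ {G : Graph n} {x y} → G x y ≡ false → ¬ Adj G x y
  ≡false⇒¬Adj = not-¬

  ¬Adj⇒≡false : ∀ {G : Graph n} {x y} → ¬ Adj G x y → G x y ≡ false
  ¬Adj⇒≡false = ¬-not

  Adj-sym : ∀ {G : Graph n} → IsSymmetric G → ∀ {x y} → Adj G x y → Adj G y x
  Adj-sym G-sym {x} {y} = trans (G-sym y x)

  IsSymmetric-intro : ∀ {G : Graph n} → (∀ {x y} → Adj G x y → Adj G y x) → IsSymmetric G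
  IsSymmetric-intro G-sym x y = ⇔→≡ (mk⇔ G-sym G-sym)

  IsEdge-sym : ∀ {u v x y} → IsEdge u v x y → IsEdge u v y x
  IsEdge-sym (inj₁ (x≡u , y≡v)) = inj₂ (y≡v , x≡u)
  IsEdge-sym (inj₂ (x≡v , y≡u)) = inj₁ (y≡u , x≡v)

  Adj-edge⁺ : ∀ {u v x y} → IsEdge u v x y → Adj (edge u v) x y
  Adj-edge⁺ {u} {v} {x} {y} uv with isEdge? u v x y
  ... | yes _  = refl
  ... | no ¬uv = ⊥-elim (¬uv uv)

  Adj-edge⁻ : ∀ {u v x y} → Adj (edge u v) x y → IsEdge u v x y
  Adj-edge⁻ {u} {v} {x} {y} e with isEdge? u v x y
  ... | yes uv = uv

  edge-sym : ∀ u v → IsSymmetric (edge u v)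
  edge-sym u v = IsSymmetric-intro (Adj-edge⁺ ∘ IsEdge-sym ∘ Adj-edge⁻)

  edge-loopless : ∀ {u v} → u ≢ v → ∀ x → edge u v x x ≡ false
  edge-loopless {u} {v} u≢v x = ¬Adj⇒≡false {edge u v} λ e → case Adj-edge⁻ {u} {v} e of λ where
    (inj₁ (refl , x≡v)) → u≢v x≡v
    (inj₂ (x≡v , refl)) → u≢v x≡v

  Adj-∪ˡ : ∀ {G K : Graph n} {x y} → Adj G x y → Adj (G ∪ K) x y
  Adj-∪ˡ Gxy rewrite Gxy = refl

  Adj-∪ʳ : ∀ {G K : Graph n} {x y} → Adj K x y → Adj (G ∪ K) x y
  Adj-∪ʳ {G} {K} {x} {y} Kxy with G x y
  ... | true  = refl
  ... | false = Kxy

  Adj-∪⁻ : ∀ {G K : Graph n} {x y} → Adj (G ∪ K) x y → Adj G x y ⊎ Adj K x y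
  Adj-∪⁻ {G} {K} {x} {y} e with G x y
  ... | true  = inj₁ refl
  ... | false = inj₂ e

  Adj-∪edge-away : ∀ {G : Graph n} {u v x y} → x ≢ u → x ≢ v → Adj (G ∪ edge u v) x y → Adj G x y
  Adj-∪edge-away {G} {u} {v} x≢u x≢v e with Adj-∪⁻ {G} {edge u v} e
  ... | inj₁ Gxy = Gxy
  ... | inj₂ uv with Adj-edge⁻ {u} {v} uv
  ...   | inj₁ (x≡u , _) = ⊥-elim (x≢u x≡u)
  ...   | inj₂ (x≡v , _) = ⊥-elim (x≢v x≡v)

  Adj-∖⁺ : ∀ {G K : Graph n} {x y} → Adj G x y → ¬ Adj K x y → Adj (G ∖ K) x y
  Adj-∖⁺ {G} {K} Gxy ¬Kxy rewrite Gxy | ¬Adj⇒≡false {K} ¬Kxy = refl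

  Adj-∖⁻ : ∀ {G K : Graph n} {x y} → Adj (G ∖ K) x y → Adj G x y × ¬ Adj K x y
  Adj-∖⁻ {G} {K} {x} {y} e with G x y | K x y
  ... | true | false = refl , λ ()

  deg-mono : ∀ {G K : Graph n} {x} → (∀ y → Adj G x y → Adj K x y) → deg G x ≤ deg K x
  deg-mono = length-filterᵇ-mono (allFin n)

  deg-< : ∀ {G K : Graph n} {x y} → (∀ z → Adj G x z → Adj K x z) → ¬ Adj G x y → Adj K x y →
          deg G x < deg K x
  deg-< {G} G⊆K ¬Gxy Kxy =
    length-filterᵇ-< (allFin n) G⊆K (∈-allFin _) (¬Adj⇒≡false {G} ¬Gxy) Kxy

  deg-≤1 : ∀ {G : Graph n} {x p} → (∀ y → Adj G x y → y ≡ p) → deg G x ≤ 1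
  deg-≤1 only-p = length-filterᵇ-≤1 (allFin n) (allFin⁺ n)
    λ y z e e′ → trans (only-p y e) (sym (only-p z e′))

  IsLeaf-intro : ∀ {G : Graph n} {x p} → Adj G x p → (∀ y → Adj G x y → y ≡ p) → IsLeaf G x
  IsLeaf-intro {G} Gxp only-p =
    ≤-antisym (deg-≤1 {G} only-p) (length-filterᵇ-pos (allFin n) (∈-allFin _) Gxp)

  deg-∪ : ∀ (G K : Graph n) x → deg (G ∪ K) x ≤ deg G x + deg K x
  deg-∪ G K x = length-filterᵇ-∨ (G x) (K x) (allFin n)

  deg-edge : ∀ u v x → deg (edge u v) x ≤ 1
  deg-edge u v x = case x ≟ u of λ where
    (yes x≡u) → deg-≤1 {edge u v} λ y e → case Adj-edge⁻ {u} {v} e of λ where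
      (inj₁ (_ , y≡v))   → y≡v
      (inj₂ (x≡v , y≡u)) → trans y≡u (trans (sym x≡u) x≡v)
    (no x≢u)  → deg-≤1 {edge u v} λ y e → case Adj-edge⁻ {u} {v} e of λ where
      (inj₁ (x≡u , _))   → ⊥-elim (x≢u x≡u)
      (inj₂ (_ , y≡u))   → y≡u

  deg-∪edge : ∀ (G : Graph n) u v x → deg (G ∪ edge u v) x ≤ deg G x + 1
  deg-∪edge G u v x = ≤-trans (deg-∪ G (edge u v) x) (+-monoʳ-≤ (deg G x) (deg-edge u v x))

  IsSimple-∪edge : ∀ {G : Graph n} {u v} → IsSimple G → u ≢ v → IsSimple (G ∪ edge u v)
  IsSimple-∪edge {G} {u} {v} (G-sym , G-loopless) u≢v =
    (λ x y → cong₂ _∨_ (G-sym x y) (edge-sym u v x y)) ,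
    (λ x → cong₂ _∨_ (G-loopless x) (edge-loopless u≢v x))

  IsSimple-∖ : ∀ {G K : Graph n} → IsSimple G → IsSymmetric K → IsSimple (G ∖ K)
  IsSimple-∖ {G} {K} (G-sym , G-loopless) K-sym =
    (λ x y → cong₂ _∧_ (G-sym x y) (cong not (K-sym x y))) ,
    (λ x → cong (_∧ not (K x x)) (G-loopless x))

  IsPCC-∖edge : ∀ {G H : Graph n} u v → IsPCC G H → IsPCC G (H ∖ edge u v)
  IsPCC-∖edge {G} {H} u v (H-simple , H⊆G , H-deg) =
    IsSimple-∖ H-simple (edge-sym u v) ,
    (λ x y → H⊆G x y ∘ H′⊆H y) ,
    (λ x → ≤-trans (deg-mono {H ∖ edge u v} {H} H′⊆H) (H-deg x))
    where
    H′⊆H : ∀ {x} y → Adj (H ∖ edge u v) x y → Adj H x y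
    H′⊆H y = proj₁ ∘ Adj-∖⁻ {H} {edge u v}

  IsPCC-∪edge : ∀ {G H : Graph n} {u v} → IsSymmetric G → IsPCC G H → u ≢ v → Adj G u v →
                deg H u ≤ 1 → deg H v ≤ 1 → IsPCC G (H ∪ edge u v)
  IsPCC-∪edge {G} {H} {u} {v} G-sym (H-simple , H⊆G , H-deg) u≢v Guv end-u end-v =
    IsSimple-∪edge H-simple u≢v , ∪⊆G , deg≤2
    where
    ∪⊆G : (H ∪ edge u v) ⊆ G
    ∪⊆G x y e with Adj-∪⁻ {H} {edge u v} e
    ... | inj₁ Hxy = H⊆G x y Hxy
    ... | inj₂ uv with Adj-edge⁻ {u} {v} uv
    ...   | inj₁ (refl , refl) = Guv
    ...   | inj₂ (refl , refl) = Adj-sym {G} G-sym Guv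

    deg≤2 : ∀ x → deg (H ∪ edge u v) x ≤ 2
    deg≤2 x = case ((x ≟ u) , (x ≟ v)) of λ where
      (yes refl , _)        → ≤-trans (deg-∪edge H u v u) (+-monoˡ-≤ 1 end-u)
      (no _     , yes refl) → ≤-trans (deg-∪edge H u v v) (+-monoˡ-≤ 1 end-v)
      (no x≢u   , no x≢v)   →
        ≤-trans (deg-mono {H ∪ edge u v} {H} (λ y → Adj-∪edge-away {H} x≢u x≢v)) (H-deg x)

  pairs : List (Fin n × Fin n)
  pairs = concatMap (λ i → map (λ j → (i , j)) (allFin n)) (allFin n)

  upperEdge : Graph n → Fin n × Fin n → Bool
  upperEdge G p = (toℕ (proj₁ p) <ᵇ toℕ (proj₂ p)) ∧ G (proj₁ p) (proj₂ p)

  concatMap-pairs : (xs ys : List (Fin n)) →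
                    concatMap (λ i → map (λ j → (i , j)) ys) xs ≡ cartesianProduct xs ys
  concatMap-pairs []       ys = refl
  concatMap-pairs (x ∷ xs) ys = cong (map (λ j → (x , j)) ys ++_) (concatMap-pairs xs ys)

  pairs-unique : Unique pairs
  pairs-unique rewrite concatMap-pairs (allFin n) (allFin n) =
    cartesianProduct⁺ (allFin⁺ n) (allFin⁺ n)

  ∈-pairs : ∀ p → p ∈ pairs
  ∈-pairs (x , y) rewrite concatMap-pairs (allFin n) (allFin n) =
    ∈-cartesianProduct⁺ (∈-allFin x) (∈-allFin y)

  upperEdge⁻ : ∀ {G x y} → upperEdge G (x , y) ≡ true → toℕ x < toℕ y × Adj G x y
  upperEdge⁻ {G} {x} {y} e with toℕ x <ᵇ toℕ y in x<y
  ... | true = <ᵇ⇒< (toℕ x) (toℕ y) (Equivalence.from T-≡ x<y) , e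

  upperEdge-ordered : ∀ G {x y} → toℕ x < toℕ y → upperEdge G (x , y) ≡ G x y
  upperEdge-ordered G x<y rewrite Equivalence.to T-≡ (<⇒<ᵇ x<y) = refl

  upperEdge-mono : ∀ {G K} → G ⊆ K → ∀ p → upperEdge G p ≡ true → upperEdge K p ≡ true
  upperEdge-mono {G} {K} G⊆K (x , y) e =
    let x<y , Gxy = upperEdge⁻ {G} e in trans (upperEdge-ordered K x<y) (G⊆K x y Gxy)

  numEdges-mono : ∀ {G K} → G ⊆ K → numEdges G ≤ numEdges K
  numEdges-mono {G} {K} G⊆K = length-filterᵇ-mono pairs (upperEdge-mono {G} {K} G⊆K)

  numEdges-<-ordered : ∀ {G K x y} → G ⊆ K → toℕ x < toℕ y →
                       ¬ Adj G x y → Adj K x y → numEdges G < numEdges K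
  numEdges-<-ordered {G} {K} {x} {y} G⊆K x<y ¬Gxy Kxy =
    length-filterᵇ-< pairs (upperEdge-mono {G} {K} G⊆K) (∈-pairs (x , y))
      (trans (upperEdge-ordered G x<y) (¬Adj⇒≡false {G} ¬Gxy)) (trans (upperEdge-ordered K x<y) Kxy)

  numEdges-< : ∀ {G K x y} → IsSymmetric G → IsSymmetric K → G ⊆ K →
               x ≢ y → ¬ Adj G x y → Adj K x y → numEdges G < numEdges K
  numEdges-< {G} {K} {x} {y} G-sym K-sym G⊆K x≢y ¬Gxy Kxy with <-cmp (toℕ x) (toℕ y)
  ... | tri< x<y _ _ = numEdges-<-ordered {G} {K} G⊆K x<y ¬Gxy Kxy
  ... | tri≈ _ x≡y _ = ⊥-elim (x≢y (toℕ-injective x≡y))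
  ... | tri> _ _ y<x = numEdges-<-ordered {G} {K} G⊆K y<x
                         (¬Gxy ∘ Adj-sym {G} G-sym) (Adj-sym {K} K-sym Kxy)

  numEdges-∪ : ∀ (G K : Graph n) → numEdges (G ∪ K) ≤ numEdges G + numEdges K
  numEdges-∪ G K = ≤-trans
    (length-filterᵇ-mono pairs λ (x , y) → trans (sym (∧-distribˡ-∨ (toℕ x <ᵇ toℕ y) _ _)))
    (length-filterᵇ-∨ (upperEdge G) (upperEdge K) pairs)

  numEdges-edge : ∀ u v → numEdges (edge u v) ≤ 1
  numEdges-edge u v = length-filterᵇ-≤1 pairs pairs-unique λ (x , y) (x′ , y′) e e′ →
    let x<y , uv    = upperEdge⁻ {edge u v} {x} {y} e
        x′<y′ , uv′ = upperEdge⁻ {edge u v} {x′} {y′} e′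
    in
    case (Adj-edge⁻ {u} {v} {x} {y} uv , Adj-edge⁻ {u} {v} {x′} {y′} uv′) of λ where
      (inj₁ (refl , refl) , inj₁ (refl , refl)) → refl
      (inj₂ (refl , refl) , inj₂ (refl , refl)) → refl
      (inj₁ (refl , refl) , inj₂ (refl , refl)) → ⊥-elim (<-asym x<y x′<y′)
      (inj₂ (refl , refl) , inj₁ (refl , refl)) → ⊥-elim (<-asym x<y x′<y′)

  numEdges-∖edge : ∀ (H : Graph n) u v → numEdges H ≤ suc (numEdges (H ∖ edge u v))
  numEdges-∖edge H u v = begin
    numEdges H                        ≤⟨ numEdges-mono {H} {H′ ∪ edge u v} H⊆H′∪uv ⟩
    numEdges (H′ ∪ edge u v)          ≤⟨ numEdges-∪ H′ (edge u v) ⟩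
    numEdges H′ + numEdges (edge u v) ≤⟨ +-monoʳ-≤ (numEdges H′) (numEdges-edge u v) ⟩
    numEdges H′ + 1                   ≡⟨ +-comm (numEdges H′) 1 ⟩
    suc (numEdges H′)                 ∎
    where
    open ≤-Reasoning
    H′ : Graph n
    H′ = H ∖ edge u v
    H⊆H′∪uv : H ⊆ (H′ ∪ edge u v)
    H⊆H′∪uv x y Hxy = case isEdge? u v x y of λ where
      (yes uv) → Adj-∪ʳ {H′} {edge u v} (Adj-edge⁺ {u} {v} uv)
      (no ¬uv) → Adj-∪ˡ {H′} {edge u v} (Adj-∖⁺ {H} {edge u v} Hxy (¬uv ∘ Adj-edge⁻ {u} {v}))

  IsPCC-join : ∀ {G H : Graph n} {u v} → IsSymmetric G → IsPCC G H → u ≢ v →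
               deg H u ≤ 1 → deg H v ≤ 1 → ¬ Adj H u v → Adj G u v →
               IsPCC G (H ∪ edge u v) × numEdges H < numEdges (H ∪ edge u v)
  IsPCC-join {G} {H} {u} {v} G-sym H-pcc u≢v end-u end-v ¬Huv Guv =
    K-pcc , numEdges-< {H} {H ∪ edge u v} (proj₁ (proj₁ H-pcc)) (proj₁ (proj₁ K-pcc))
              (λ x y → Adj-∪ˡ {H} {edge u v}) u≢v ¬Huv
              (Adj-∪ʳ {H} {edge u v} (Adj-edge⁺ {u} {v} (inj₁ (refl , refl))))
    where
    K-pcc : IsPCC G (H ∪ edge u v)
    K-pcc = IsPCC-∪edge G-sym H-pcc u≢v Guv end-u end-v

  maxPCC-endpoints-nonadjacent : ∀ {G H : Graph n} {u v} → IsSymmetric G → IsMaxPCC G H → u ≢ v →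
                                 deg H u ≤ 1 → deg H v ≤ 1 → ¬ Adj H u v → ¬ Adj G u v
  maxPCC-endpoints-nonadjacent G-sym (H-pcc , maximal) u≢v end-u end-v ¬Huv Guv =
    let K-pcc , H<K = IsPCC-join G-sym H-pcc u≢v end-u end-v ¬Huv Guv in
    ≤⇒≯ (maximal _ K-pcc) H<K

  Distinct₄ : Fin n → Fin n → Fin n → Fin n → Set
  Distinct₄ a b c d = a ≢ b × a ≢ c × a ≢ d × b ≢ c × b ≢ d × c ≢ d

  maxPCC-no-exchange : ∀ {G H : Graph n} {a b c d} → IsSymmetric G → IsMaxPCC G H →
                       Distinct₄ a b c d → Adj H b c → deg H a ≤ 1 → deg H d ≤ 1 →
                       ¬ Adj H a c → ¬ Adj H b d → Adj G a c → ¬ Adj G b d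
  maxPCC-no-exchange {G} {H} {a} {b} {c} {d} G-sym (H-pcc@((H-sym , _) , _ , H-deg) , maximal)
    (a≢b , a≢c , a≢d , b≢c , b≢d , c≢d) Hbc end-a end-d ¬Hac ¬Hbd Gac Gbd =
    ≤⇒≯ (maximal K₂ (proj₁ K₂-join)) (begin-strict
      numEdges H        ≤⟨ numEdges-∖edge H b c ⟩
      suc (numEdges H′) ≤⟨ proj₂ K₁-join ⟩
      numEdges K₁       <⟨ proj₂ K₂-join ⟩
      numEdges K₂       ∎)
    where
    open ≤-Reasoning
    H′ K₁ K₂ : Graph n
    H′ = H ∖ edge b c
    K₁ = H′ ∪ edge a c
    K₂ = K₁ ∪ edge b d

    H′⊆H : ∀ {x} y → Adj H′ x y → Adj H x y
    H′⊆H y = proj₁ ∘ Adj-∖⁻ {H} {edge b c}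

    H′-end : ∀ {x y} → Adj H x y → IsEdge b c x y → deg H′ x ≤ 1
    H′-end {x} {y} Hxy bc = s≤s⁻¹ (≤-trans (deg-< {H′} {H} H′⊆H lost Hxy) (H-deg x))
      where
      lost : ¬ Adj H′ x y
      lost H′xy = proj₂ (Adj-∖⁻ {H} {edge b c} H′xy) (Adj-edge⁺ {b} {c} bc)

    K₁-away : ∀ {x} → x ≢ a → x ≢ c → ∀ y → Adj K₁ x y → Adj H′ x y
    K₁-away x≢a x≢c y = Adj-∪edge-away {H′} x≢a x≢c

    K₁-join : IsPCC G K₁ × numEdges H′ < numEdges K₁
    K₁-join = IsPCC-join {G} {H′} G-sym (IsPCC-∖edge b c H-pcc) a≢c
      (≤-trans (deg-mono {H′} {H} H′⊆H) end-a)
      (H′-end (Adj-sym {H} H-sym Hbc) (inj₂ (refl , refl)))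
      (¬Hac ∘ H′⊆H c) Gac

    K₂-join : IsPCC G K₂ × numEdges K₁ < numEdges K₂
    K₂-join = IsPCC-join {G} {K₁} G-sym (proj₁ K₁-join) b≢d
      (≤-trans (deg-mono {K₁} {H′} (K₁-away (a≢b ∘ sym) b≢c)) (H′-end Hbc (inj₁ (refl , refl))))
      (≤-trans (deg-mono {K₁} {H′} (K₁-away (a≢d ∘ sym) (c≢d ∘ sym)))
        (≤-trans (deg-mono {H′} {H} H′⊆H) end-d))
      (¬Hbd ∘ H′⊆H d ∘ K₁-away (a≢b ∘ sym) b≢c d) Gbd

  In4? : ∀ (a b c d x : Fin n) → Dec (In4 a b c d x)
  In4? a b c d x = (x ≟ a) ⊎-dec (x ≟ b) ⊎-dec (x ≟ c) ⊎-dec (x ≟ d)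

  In4⇒b⊎c : ∀ {P : Fin n → Set} {a b c d y} → In4 a b c d y → P y → ¬ P a → ¬ P d → y ≡ b ⊎ y ≡ c
  In4⇒b⊎c (inj₁ refl)               Py ¬Pa _   = ⊥-elim (¬Pa Py)
  In4⇒b⊎c (inj₂ (inj₁ y≡b))         _  _   _   = inj₁ y≡b
  In4⇒b⊎c (inj₂ (inj₂ (inj₁ y≡c)))  _  _   _   = inj₂ y≡c
  In4⇒b⊎c (inj₂ (inj₂ (inj₂ refl))) Py _   ¬Pd = ⊥-elim (¬Pd Py)

  non-leaf⇒second-neighbour : ∀ {G : Graph n} {x p q} → ¬ IsLeaf G x → Adj G x p →
                              (∀ y → Adj G x y → y ≡ p ⊎ y ≡ q) → Adj G x q
  non-leaf⇒second-neighbour {G} {x} {p} {q} ¬leaf Gxp neighbours with G x q in Gxq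
  ... | true  = refl
  ... | false = ⊥-elim (¬leaf (IsLeaf-intro {G} Gxp only-p))
    where
    only-p : ∀ y → Adj G x y → y ≡ p
    only-p y Gxy with neighbours y Gxy
    ... | inj₁ y≡p  = y≡p
    ... | inj₂ refl = case trans (sym Gxq) Gxy of λ ()

  maxPCC-P3-end-not-enclosed : ∀ {G H : Graph n} {a b c d} → IsSimple G → IsMaxPCC G H →
    IsPathComp3 H a b c d → ¬ IsLeaf G a → ¬ IsLeaf G d →
    ¬ (∀ w → Adj G a w ⊎ Adj G d w → In4 a b c d w)
  maxPCC-P3-end-not-enclosed {G} {H} {a} {b} {c} {d} (G-sym , G-loopless)
    H-max@(((H-sym , H-loopless) , H⊆G , _) , _)
    (distinct@(_ , _ , a≢d , _) , (Hab , Hbc , Hcd) , (¬Hac , ¬Hbd , ¬Had) , closed)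
    ¬leaf-a ¬leaf-d enclosed =
    maxPCC-no-exchange G-sym H-max distinct Hbc end-a end-d ¬Hac ¬Hbd Gac (Adj-sym {G} G-sym Gdb)
    where
    end-a : deg H a ≤ 1
    end-a = deg-≤1 {H} λ y Hay →
      case In4⇒b⊎c {Adj H a} (closed a y Hay (inj₁ refl)) Hay
             (≡false⇒¬Adj {H} (H-loopless a)) ¬Had of λ where
        (inj₁ y≡b)  → y≡b
        (inj₂ refl) → ⊥-elim (¬Hac Hay)

    end-d : deg H d ≤ 1
    end-d = deg-≤1 {H} λ y Hdy →
      case In4⇒b⊎c {Adj H d} (closed d y Hdy (inj₂ (inj₂ (inj₂ refl)))) Hdy
             (¬Had ∘ Adj-sym {H} H-sym) (≡false⇒¬Adj {H} (H-loopless d)) of λ where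
        (inj₁ refl) → ⊥-elim (¬Hbd (Adj-sym {H} H-sym Hdy))
        (inj₂ y≡c)  → y≡c

    ¬Gad : ¬ Adj G a d
    ¬Gad = maxPCC-endpoints-nonadjacent G-sym H-max a≢d end-a end-d ¬Had

    G-neighbours-a : ∀ y → Adj G a y → y ≡ b ⊎ y ≡ c
    G-neighbours-a y Gay =
      In4⇒b⊎c {Adj G a} (enclosed y (inj₁ Gay)) Gay (≡false⇒¬Adj {G} (G-loopless a)) ¬Gad

    G-neighbours-d : ∀ y → Adj G d y → y ≡ b ⊎ y ≡ c
    G-neighbours-d y Gdy =
      In4⇒b⊎c {Adj G d} (enclosed y (inj₂ Gdy)) Gdy
        (¬Gad ∘ Adj-sym {G} G-sym) (≡false⇒¬Adj {G} (G-loopless d))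

    Gac : Adj G a c
    Gac = non-leaf⇒second-neighbour {G} ¬leaf-a (H⊆G a b Hab) G-neighbours-a

    Gdb : Adj G d b
    Gdb = non-leaf⇒second-neighbour {G} ¬leaf-d (H⊆G d c (Adj-sym {H} H-sym Hcd))
            (λ y → swap ∘ G-neighbours-d y)

lemma8 : ∀ {n} (G₁ : Graph n) →
    IsSimple G₁ → Connected G₁ → ¬ IsTree G₁ → Reduced G₁ →
    (∀ H → IsMaxPCC G₁ H → ¬ Connected H) →
    ∀ (H : Graph n) → IsMaxPCC G₁ H →
    ∀ (a b c d : Fin n) → IsPathComp3 H a b c d →
    ¬ IsLeaf G₁ a → ¬ IsLeaf G₁ d →
    Σ (Fin n) λ w → ¬ In4 a b c d w × (Adj G₁ a w ⊎ Adj G₁ d w)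
lemma8 G₁ G₁-simple _ _ _ _ H H-max a b c d path ¬leaf-a ¬leaf-d
  with any? (λ w → ¬? (In4? a b c d w) ×-dec (Adj? G₁ a w ⊎-dec Adj? G₁ d w))
... | yes escape = escape
... | no ¬escape = ⊥-elim (maxPCC-P3-end-not-enclosed G₁-simple H-max path ¬leaf-a ¬leaf-d enclosed)
  where
  enclosed : ∀ w → Adj G₁ a w ⊎ Adj G₁ d w → In4 a b c d w
  enclosed w adj = decidable-stable (In4? a b c d w) λ w∉ → ¬escape (w , w∉ , adj)
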